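{- Let $k\ge 1$ and let $G=(V\cup\{m\},E)$ and $G'=(V'\cup\{m'\},E')$ be two graphs with disjoint vertex sets. If $G$ and $G'$ are both $k$-word-representable, then the split recomposition $G\ast G'$ (with marked vertices $m$ and $m'$) is $k$-word-representable.
   Context: All graphs are finite, simple and connected. A word over an alphabet is a finite sequence of letters; for a word $w$ and a set $B$ of letters, $w_B$ denotes the subword of $w$ consisting of all occurrences of letters of $B$. Two letters $a,b$ alternate in $w$ if $w_{\{a,b\}}$ is of the form $abab\cdots$ or $baba\cdots$ (of even or odd length). A graph $G=(V,E)$ is word-representable if there is a word $w$ over $V$ (containing every vertex) such that for all distinct $a,b\in V$, $a$ and $b$ are adjacent iff they alternate in $w$. A word is $k$-uniform if each letter occurs exactly $k$ times; $G$ is $k$-word-representable if it is represented by a $k$-uniform word. Split recomposition: for graphs $G=(V\cup\{m\},E)$ and $G'=(V'\cup\{m'\},E')$ with disjoint vertex sets, $G\ast G'$ is the graph with vertex set $V\cup V'$ whose edges are the edges of the induced subgraph $G[V]$, the edges of $G'[V']$, and all edges $\overline{ab}$ with $a\in N_G(m)$ and $b\in N_{G'}(m')$ ($N$ denotes neighborhood). -}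

module Defs where

open import Data.Nat using (ℕ; zero; suc)
open import Data.Fin using (Fin)
import Data.Fin.Properties as FinP
open import Data.Maybe using (Maybe; just; nothing)
import Data.Maybe.Properties as MaybeP
open import Data.Sum using (_⊎_; inj₁; inj₂)
import Data.Sum.Properties as SumP
open import Data.Product using (Σ; ∃; _×_; _,_; proj₁; proj₂)
open import Data.List using (List; []; _∷_; filter; length)
open import Data.List.Membership.Propositional using (_∈_)
open import Relation.Nullary using (¬_)
open import Relation.Nullary.Decidable using (_⊎-dec_)
open import Relation.Binary.Definitions using (DecidableEquality)
open import Relation.Binary.PropositionalEquality using (_≡_; _≢_)
open import Relation.Binary.Construct.Closure.ReflexiveTransitive using (Star)
open import Function.Bundles using (_⇔_)

record Graph (V : Set) : Set₁ where
  field
    Adj    : V → V → Set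
    sym    : ∀ {x y} → Adj x y → Adj y x
    irrefl : ∀ {x} → ¬ Adj x x
open Graph public

Connected : ∀ {V} → Graph V → Set
Connected {V} G = ∀ (x y : V) → Star (Adj G) x y

module _ {A : Set} (_≟_ : DecidableEquality A) where

  count : A → List A → ℕ
  count x w = length (filter (λ y → y ≟ x) w)

  Uniform : ℕ → List A → Set
  Uniform k w = ∀ x → count x w ≡ k

  sub2 : A → A → List A → List A
  sub2 a b w = filter (λ y → (y ≟ a) ⊎-dec (y ≟ b)) w

  altWord : A → A → ℕ → List A
  altWord a b zero    = []
  altWord a b (suc n) = a ∷ altWord b a n

  Alternate : A → A → List A → Set
  Alternate a b w = ∃ λ n → (sub2 a b w ≡ altWord a b n) ⊎ (sub2 a b w ≡ altWord b a n)

  Represents : Graph A → List A → Set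
  Represents G w = (∀ x → x ∈ w) × (∀ a b → a ≢ b → (Adj G a b ⇔ Alternate a b w))

  KRepresentable : ℕ → Graph A → Set
  KRepresentable k G = ∃ λ w → Uniform k w × Represents G w

-- Vertex set V ∪ {m} encoded as Maybe (Fin n): just v ∈ V, nothing = m.
decM : ∀ {n} → DecidableEquality (Maybe (Fin n))
decM = MaybeP.≡-dec FinP._≟_

decS : ∀ {n n'} → DecidableEquality (Fin n ⊎ Fin n')
decS = SumP.≡-dec FinP._≟_ FinP._≟_

-- Split recomposition G ∗ G' with marked vertices m = nothing, m' = nothing.
SplitAdj : ∀ {n n'} → Graph (Maybe (Fin n)) → Graph (Maybe (Fin n')) →
           Fin n ⊎ Fin n' → Fin n ⊎ Fin n' → Set
SplitAdj G G' (inj₁ a) (inj₁ b) = Adj G (just a) (just b)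
SplitAdj G G' (inj₂ a) (inj₂ b) = Adj G' (just a) (just b)
SplitAdj G G' (inj₁ a) (inj₂ b) = Adj G (just a) nothing × Adj G' (just b) nothing
SplitAdj G G' (inj₂ b) (inj₁ a) = Adj G (just a) nothing × Adj G' (just b) nothing

_∗_ : ∀ {n n'} → Graph (Maybe (Fin n)) → Graph (Maybe (Fin n')) → Graph (Fin n ⊎ Fin n')
G ∗ G' = record { Adj = SplitAdj G G' ; sym = λ {x} {y} → s {x} {y} ; irrefl = λ {x} → i {x} }
  where
  s : ∀ {x y} → SplitAdj G G' x y → SplitAdj G G' y x
  s {inj₁ a} {inj₁ b} p = sym G p
  s {inj₂ a} {inj₂ b} p = sym G' p
  s {inj₁ a} {inj₂ b} p = p
  s {inj₂ a} {inj₁ b} p = p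
  i : ∀ {x} → ¬ SplitAdj G G' x x
  i {inj₁ a} = irrefl G
  i {inj₂ a} = irrefl G'

-- Rotate the k-uniform word w' representing G' (a cyclic shift of a uniform representant
-- represents the same graph) so that it ends with m', i.e. w' = B₁ m' B₂ m' ⋯ B_k m'.
-- Replace the i-th occurrence of m in the representant w of G by the block B_i. Inside V and
-- inside V' the letters keep their relative order, so those pairs alternate exactly as before.
-- For a ∈ V and b ∈ V': if b ~ m', every block contains exactly one b, so the a,b-subword is the
-- a,m-subword of w with m renamed to b; conversely, if a and b alternate, no block contains two
-- b's, and as there are k b's in k blocks each block contains exactly one, so b ~ m' and then
-- a ~ m.
module Submission where

open import Defs hiding (sym)
open import Data.Nat using (ℕ; zero; suc; _+_; _≤_; z≤n; s≤s)
open import Data.Nat.Properties using (+-comm; suc-injective; m≤n⇒m≤1+n; 1+n≰n)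
open import Data.Fin using (Fin)
import Data.Fin.Properties as FinP
open import Data.Maybe using (Maybe; just; nothing; maybe′)
open import Data.Maybe.Properties using (just-injective)
import Data.Maybe.Properties as MaybeP
import Data.Maybe.Relation.Unary.All as MaybeAll
open import Data.Sum using (_⊎_; inj₁; inj₂; [_,_]′; isInj₁; isInj₂)
import Data.Sum as Sum
import Data.Sum.Properties as SumP
open import Data.Product using (∃; _×_; _,_; proj₁; proj₂)
import Data.Product as Product
open import Data.List using (List; []; _∷_; _++_; _∷ʳ_; [_]; map; filter; length; catMaybes; mapMaybe)
open import Data.List.Properties
  using (filter-accept; filter-reject; filter-++; filter-≐; length-++; length-map; ++-assoc; ++-identityʳ;
         map-injective; map-id; mapMaybeIsInj₁∘mapInj₂; mapMaybeIsInj₂∘mapInj₂)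
open import Data.List.Relation.Unary.All as All using (All)
open import Data.List.Relation.Unary.All.Properties using (all-filter)
open import Data.List.Relation.Unary.Any using (here; there)
open import Data.List.Relation.Unary.Linked as Linked using (Linked; []; [-]; _∷_)
open import Data.List.Membership.Propositional using (_∈_)
open import Data.List.Membership.Propositional.Properties using (∈-∃++)
open import Data.Empty using (⊥-elim)
open import Level using (0ℓ)
open import Relation.Nullary using (¬_; yes; no)
open import Relation.Nullary.Decidable using (_⊎-dec_)
open import Relation.Unary using (Pred; Decidable)
open import Relation.Binary.Definitions using (DecidableEquality)
open import Relation.Binary.PropositionalEquality
  using (_≡_; _≢_; refl; sym; trans; cong; cong₂; subst; ≢-sym; module ≡-Reasoning)
open import Function.Base using (_∘_; id)
open import Function.Definitions using (Injective)
open import Function.Bundles using (_⇔_; mk⇔; Equivalence)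
open import Function.Construct.Symmetry using (⇔-sym)
open import Function.Construct.Composition using (_⇔-∘_)
open import Function.Related.Propositional using (module EquationalReasoning)
open import Data.Product.Function.NonDependent.Propositional using (_×-⇔_)

double : ℕ → ℕ
double zero    = zero
double (suc n) = suc (suc (double n))

SeparatedBy : ∀ {A : Set} → A → List A → Set
SeparatedBy c = Linked (λ x y → x ≡ c ⊎ y ≡ c)

SeparatedBy-∷ : ∀ {A : Set} {c : A} {u} → SeparatedBy c u → SeparatedBy c (c ∷ u)
SeparatedBy-∷ []          = [-]
SeparatedBy-∷ sep@[-]     = inj₁ refl ∷ sep
SeparatedBy-∷ sep@(_ ∷ _) = inj₁ refl ∷ sep

module Words {A : Set} (_≟_ : DecidableEquality A) where

  Balanced : A → A → List A → Set
  Balanced a b u = count _≟_ a u ≡ count _≟_ b u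

  Alternating : A → A → List A → Set
  Alternating a b u = ∃ λ n → u ≡ altWord _≟_ a b n ⊎ u ≡ altWord _≟_ b a n

  pair? : ∀ a b → Decidable (λ y → y ≡ a ⊎ y ≡ b)
  pair? a b y = (y ≟ a) ⊎-dec (y ≟ b)

  count-here : ∀ x u → count _≟_ x (x ∷ u) ≡ suc (count _≟_ x u)
  count-here x u = cong length (filter-accept (_≟ x) refl)

  count-there : ∀ {x y} u → y ≢ x → count _≟_ x (y ∷ u) ≡ count _≟_ x u
  count-there {x} u y≢x = cong length (filter-reject (_≟ x) y≢x)

  count-∷-∷ : ∀ {a b} → a ≢ b → ∀ u →
              count _≟_ a (a ∷ b ∷ u) ≡ suc (count _≟_ a u) × count _≟_ b (a ∷ b ∷ u) ≡ suc (count _≟_ b u)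
  count-∷-∷ {a} {b} a≢b u =
    trans (count-here a _) (cong suc (count-there u (≢-sym a≢b))) , trans (count-there _ a≢b) (count-here b u)

  count-++ : ∀ x u v → count _≟_ x (u ++ v) ≡ count _≟_ x u + count _≟_ x v
  count-++ x u v = trans (cong length (filter-++ (_≟ x) u v)) (length-++ (filter (_≟ x) u))

  count-++-comm : ∀ x u v → count _≟_ x (u ++ v) ≡ count _≟_ x (v ++ u)
  count-++-comm x u v = trans (count-++ x u v) (trans (+-comm (count _≟_ x u) _) (sym (count-++ x v u)))

  count-filter : ∀ {P : Pred A 0ℓ} (P? : Decidable P) {x} u → P x → count _≟_ x (filter P? u) ≡ count _≟_ x u
  count-filter P? [] _ = refl
  count-filter P? {x} (y ∷ u) px with P? y
  ... | yes _ with y ≟ x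
  ...   | yes _ = cong suc (count-filter P? u px)
  ...   | no _  = count-filter P? u px
  count-filter P? {x} (y ∷ u) px | no ¬py with y ≟ x
  ...   | yes refl = ⊥-elim (¬py px)
  ...   | no _     = count-filter P? u px

  count≡length-sub2 : ∀ x u → count _≟_ x u ≡ length (sub2 _≟_ x x u)
  count≡length-sub2 x u = cong length (filter-≐ (_≟ x) (pair? x x) (inj₁ , [ id , id ]′) u)

  count≡suc⇒∈ : ∀ {x u m} → count _≟_ x u ≡ suc m → x ∈ u
  count≡suc⇒∈ {x} {y ∷ u} e with y ≟ x
  ... | yes refl = here refl
  ... | no _     = there (count≡suc⇒∈ e)

  Balanced-∷-∷ : ∀ {a b} → a ≢ b → ∀ u → Balanced a b (a ∷ b ∷ u) → Balanced a b u
  Balanced-∷-∷ a≢b u bal =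
    suc-injective (trans (sym (proj₁ (count-∷-∷ a≢b u))) (trans bal (proj₂ (count-∷-∷ a≢b u))))

  Balanced-++-comm : ∀ {a b} u v → Balanced a b (u ++ v) → Balanced a b (v ++ u)
  Balanced-++-comm {a} {b} u v bal = trans (sym (count-++-comm a u v)) (trans bal (count-++-comm b u v))

  Balanced-sub2 : ∀ {a b} u → Balanced a b u → Balanced a b (sub2 _≟_ a b u)
  Balanced-sub2 {a} {b} u bal =
    trans (count-filter (pair? a b) u (inj₁ refl)) (trans bal (sym (count-filter (pair? a b) u (inj₂ refl))))

  Alternating-sym : ∀ {a b u} → Alternating a b u → Alternating b a u
  Alternating-sym (n , e) = n , Sum.swap e

  sub2-comm : ∀ a b u → sub2 _≟_ a b u ≡ sub2 _≟_ b a u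
  sub2-comm a b = filter-≐ (pair? a b) (pair? b a) (Sum.swap , Sum.swap)

  Alternate-sym : ∀ a b u → Alternate _≟_ a b u ⇔ Alternate _≟_ b a u
  Alternate-sym a b u = mk⇔ (subst (Alternating b a) (sub2-comm a b u) ∘ Alternating-sym)
                            (subst (Alternating a b) (sub2-comm b a u) ∘ Alternating-sym)

  Balanced-altWord⇒double : ∀ {a b} → a ≢ b → ∀ n → Balanced a b (altWord _≟_ a b n) → ∃ λ j → n ≡ double j
  Balanced-altWord⇒double a≢b zero _ = zero , refl
  Balanced-altWord⇒double {a} a≢b (suc zero) bal
    with () ← trans (sym (count-here a [])) (trans bal (count-there [] a≢b))
  Balanced-altWord⇒double a≢b (suc (suc n)) bal
    with j , refl ← Balanced-altWord⇒double a≢b n (Balanced-∷-∷ a≢b _ bal) = suc j , refl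

  altWord-∷ʳ : ∀ a b j → altWord _≟_ a b (suc (double j)) ∷ʳ b ≡ altWord _≟_ a b (double (suc j))
  altWord-∷ʳ a b zero    = refl
  altWord-∷ʳ a b (suc j) = cong (λ r → a ∷ b ∷ r) (altWord-∷ʳ a b j)

  altWord-rotate : ∀ {a b c u} n → a ≢ b → Balanced a b (altWord _≟_ a b n) → c ∷ u ≡ altWord _≟_ a b n →
                   ∃ λ m → u ∷ʳ c ≡ altWord _≟_ b a m
  altWord-rotate n a≢b bal e with Balanced-altWord⇒double a≢b n bal
  ... | zero  , refl with () ← e
  ... | suc j , refl with refl ← e = double (suc j) , altWord-∷ʳ _ _ j

  Alternating-rotate : ∀ {a b c u} → a ≢ b → Balanced a b (c ∷ u) → Alternating a b (c ∷ u) →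
                       Alternating a b (u ∷ʳ c)
  Alternating-rotate a≢b bal (n , inj₁ e) =
    Product.map₂ inj₂ (altWord-rotate n a≢b (subst (Balanced _ _) e bal) e)
  Alternating-rotate a≢b bal (n , inj₂ e) =
    Product.map₂ inj₁ (altWord-rotate n (≢-sym a≢b) (subst (Balanced _ _) e (sym bal)) e)

  Alternating-++-comm : ∀ {a b} → a ≢ b → ∀ u v → Balanced a b (u ++ v) → Alternating a b (u ++ v) →
                        Alternating a b (v ++ u)
  Alternating-++-comm a≢b [] v _ alt = subst (Alternating _ _) (sym (++-identityʳ v)) alt
  Alternating-++-comm {a} {b} a≢b (c ∷ u) v bal alt =
    subst (Alternating a b) (++-assoc v [ c ] u)
      (Alternating-++-comm a≢b u (v ∷ʳ c)
        (subst (Balanced a b) (++-assoc u v [ c ]) (Balanced-++-comm [ c ] (u ++ v) bal))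
        (subst (Alternating a b) (++-assoc u v [ c ]) (Alternating-rotate a≢b bal alt)))

  Alternate-++-comm : ∀ {a b} → a ≢ b → ∀ u v → Balanced a b (u ++ v) → Alternate _≟_ a b (u ++ v) →
                      Alternate _≟_ a b (v ++ u)
  Alternate-++-comm {a} {b} a≢b u v bal alt =
    subst (Alternating a b) (sym (filter-++ (pair? a b) v u))
      (Alternating-++-comm a≢b (sub2 _≟_ a b u) (sub2 _≟_ a b v)
        (subst (Balanced a b) (filter-++ (pair? a b) u v) (Balanced-sub2 (u ++ v) bal))
        (subst (Alternating a b) (filter-++ (pair? a b) u v) alt))

  Uniform-++-comm : ∀ {k} u v → Uniform _≟_ k (u ++ v) → Uniform _≟_ k (v ++ u)
  Uniform-++-comm u v uni x = trans (count-++-comm x v u) (uni x)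

  Alternate-++-comm-⇔ : ∀ {k} u v → Uniform _≟_ k (u ++ v) → ∀ a b → a ≢ b →
                        Alternate _≟_ a b (u ++ v) ⇔ Alternate _≟_ a b (v ++ u)
  Alternate-++-comm-⇔ u v uni a b a≢b =
    mk⇔ (Alternate-++-comm a≢b u v (trans (uni a) (sym (uni b))))
        (Alternate-++-comm a≢b v u (trans (Uniform-++-comm u v uni a) (sym (Uniform-++-comm u v uni b))))

  rotate-to-end : ∀ {k c} w → Uniform _≟_ k w → c ∈ w →
                  ∃ λ v₀ → Uniform _≟_ k (v₀ ∷ʳ c) ×
                           (∀ a b → a ≢ b → Alternate _≟_ a b w ⇔ Alternate _≟_ a b (v₀ ∷ʳ c))
  rotate-to-end {k} {c} w uni c∈w with ys , zs , refl ← ∈-∃++ c∈w rewrite sym (++-assoc ys [ c ] zs) =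
    zs ++ ys ,
    subst (Uniform _≟_ k) v≡ (Uniform-++-comm (ys ∷ʳ c) zs uni) ,
    λ a b a≢b → subst (λ v → Alternate _≟_ a b (ys ∷ʳ c ++ zs) ⇔ Alternate _≟_ a b v) v≡
                      (Alternate-++-comm-⇔ (ys ∷ʳ c) zs uni a b a≢b)
    where
    v≡ : zs ++ ys ∷ʳ c ≡ (zs ++ ys) ∷ʳ c
    v≡ = sym (++-assoc zs ys [ c ])

  count-altWord-double : ∀ {a b} → a ≢ b → ∀ j → count _≟_ b (altWord _≟_ a b (double j)) ≡ j
  count-altWord-double a≢b zero    = refl
  count-altWord-double a≢b (suc j) =
    trans (proj₂ (count-∷-∷ a≢b _)) (cong suc (count-altWord-double a≢b j))

  altWord-separated : ∀ a b n → SeparatedBy a (altWord _≟_ a b n) × SeparatedBy b (altWord _≟_ a b n)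
  altWord-separated a b zero          = [] , []
  altWord-separated a b (suc zero)    = [-] , [-]
  altWord-separated a b (suc (suc n)) with sep-b , sep-a ← altWord-separated b a (suc n) =
    inj₁ refl ∷ sep-a , inj₂ refl ∷ sep-b

  Alternating⇒SeparatedBy : ∀ {a b u} → Alternating a b u → SeparatedBy a u × SeparatedBy b u
  Alternating⇒SeparatedBy (n , inj₁ refl) = altWord-separated _ _ n
  Alternating⇒SeparatedBy (n , inj₂ refl) = Product.swap (altWord-separated _ _ n)

  module _ {x y : A} (x≢y : x ≢ y) where

    SeparatedBy-count≤ : ∀ u → All (λ z → z ≡ x ⊎ z ≡ y) u → SeparatedBy y (u ∷ʳ y) →
                         count _≟_ x (u ∷ʳ y) ≤ count _≟_ y (u ∷ʳ y)
    SeparatedBy-count≤ [] _ _ rewrite count-there [] (≢-sym x≢y) = z≤n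
    SeparatedBy-count≤ (_ ∷ u) (inj₂ refl All.∷ u∈xy) sep
      rewrite count-there (u ∷ʳ y) (≢-sym x≢y) | count-here y (u ∷ʳ y) =
      m≤n⇒m≤1+n (SeparatedBy-count≤ u u∈xy (Linked.tail sep))
    SeparatedBy-count≤ (_ ∷ []) (inj₁ refl All.∷ _) _
      rewrite proj₁ (count-∷-∷ x≢y []) | proj₂ (count-∷-∷ x≢y []) = s≤s z≤n
    SeparatedBy-count≤ (_ ∷ _ ∷ _) (inj₁ refl All.∷ inj₁ refl All.∷ _) (x≡y ∷ _) =
      ⊥-elim ([ x≢y , x≢y ]′ x≡y)
    SeparatedBy-count≤ (_ ∷ _ ∷ u) (inj₁ refl All.∷ inj₂ refl All.∷ u∈xy) sep
      rewrite proj₁ (count-∷-∷ x≢y (u ∷ʳ y)) | proj₂ (count-∷-∷ x≢y (u ∷ʳ y)) =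
      s≤s (SeparatedBy-count≤ u u∈xy (Linked.tail (Linked.tail sep)))

    SeparatedBy-Balanced⇒pairs : ∀ u → All (λ z → z ≡ x ⊎ z ≡ y) u → SeparatedBy y (u ∷ʳ y) →
                                 Balanced x y (u ∷ʳ y) → ∃ λ j → u ∷ʳ y ≡ altWord _≟_ x y (double j)
    SeparatedBy-Balanced⇒pairs [] _ _ bal
      with () ← trans (sym (count-there [] (≢-sym x≢y))) (trans bal (count-here y []))
    SeparatedBy-Balanced⇒pairs (_ ∷ u) (inj₂ refl All.∷ u∈xy) sep bal =
      ⊥-elim (1+n≰n (subst (_≤ count _≟_ y (u ∷ʳ y)) bal′ (SeparatedBy-count≤ u u∈xy (Linked.tail sep))))
      where
      bal′ : count _≟_ x (u ∷ʳ y) ≡ suc (count _≟_ y (u ∷ʳ y))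
      bal′ = trans (sym (count-there _ (≢-sym x≢y))) (trans bal (count-here y _))
    SeparatedBy-Balanced⇒pairs (_ ∷ []) (inj₁ refl All.∷ _) _ _ = 1 , refl
    SeparatedBy-Balanced⇒pairs (_ ∷ _ ∷ _) (inj₁ refl All.∷ inj₁ refl All.∷ _) (x≡y ∷ _) _ =
      ⊥-elim ([ x≢y , x≢y ]′ x≡y)
    SeparatedBy-Balanced⇒pairs (_ ∷ _ ∷ u) (inj₁ refl All.∷ inj₂ refl All.∷ u∈xy) sep bal
      with j , e ← SeparatedBy-Balanced⇒pairs u u∈xy (Linked.tail (Linked.tail sep)) (Balanced-∷-∷ x≢y _ bal) =
      suc j , cong (λ r → x ∷ y ∷ r) e

module _ {A B : Set} (_≟A_ : DecidableEquality A) (_≟B_ : DecidableEquality B) where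

  map-altWord : ∀ (f : A → B) a b n → map f (altWord _≟A_ a b n) ≡ altWord _≟B_ (f a) (f b) n
  map-altWord f a b zero    = refl
  map-altWord f a b (suc n) = cong (f a ∷_) (map-altWord f b a n)

  Alternating-map : ∀ {f : A → B} → Injective _≡_ _≡_ f → ∀ {a b} u →
                    Words.Alternating _≟A_ a b u ⇔ Words.Alternating _≟B_ (f a) (f b) (map f u)
  Alternating-map {f} f-inj {a} {b} u = mk⇔ to from
    where
    to : Words.Alternating _≟A_ a b u → Words.Alternating _≟B_ (f a) (f b) (map f u)
    to (n , inj₁ refl) = n , inj₁ (map-altWord f a b n)
    to (n , inj₂ refl) = n , inj₂ (map-altWord f b a n)
    from : Words.Alternating _≟B_ (f a) (f b) (map f u) → Words.Alternating _≟A_ a b u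
    from (n , inj₁ e) = n , inj₁ (map-injective f-inj (trans e (sym (map-altWord f a b n))))
    from (n , inj₂ e) = n , inj₂ (map-injective f-inj (trans e (sym (map-altWord f b a n))))

module Projection {A B : Set} (_≟A_ : DecidableEquality A) (_≟B_ : DecidableEquality B)
  (emb : A → B) (proj : B → Maybe A)
  (proj-emb : ∀ x → proj (emb x) ≡ just x) (emb-proj : ∀ {y x} → proj y ≡ just x → emb x ≡ y) where

  private
    module WA = Words _≟A_
    module WB = Words _≟B_

  emb-injective : Injective _≡_ _≡_ emb
  emb-injective {x} {x'} e = just-injective (trans (sym (proj-emb x)) (trans (cong proj e) (proj-emb x')))

  sub2-mapMaybe : ∀ a b u → sub2 _≟B_ (emb a) (emb b) u ≡ map emb (sub2 _≟A_ a b (mapMaybe proj u))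
  sub2-mapMaybe a b [] = refl
  sub2-mapMaybe a b (y ∷ u) with proj y in eq
  ... | nothing = trans (filter-reject (WB.pair? (emb a) (emb b)) y∉ab) (sub2-mapMaybe a b u)
    where
    y∉ab : ¬ (y ≡ emb a ⊎ y ≡ emb b)
    y∉ab (inj₁ refl) with () ← trans (sym eq) (proj-emb a)
    y∉ab (inj₂ refl) with () ← trans (sym eq) (proj-emb b)
  ... | just x with refl ← emb-proj eq with WA.pair? a b x
  ...   | yes x∈ab = begin
      filter (WB.pair? (emb a) (emb b)) (emb x ∷ u)
        ≡⟨ filter-accept (WB.pair? (emb a) (emb b)) (Sum.map (cong emb) (cong emb) x∈ab) ⟩
      emb x ∷ sub2 _≟B_ (emb a) (emb b) u
        ≡⟨ cong (emb x ∷_) (sub2-mapMaybe a b u) ⟩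
      map emb (x ∷ sub2 _≟A_ a b (mapMaybe proj u))
        ≡⟨ cong (map emb) (filter-accept (WA.pair? a b) x∈ab) ⟨
      map emb (sub2 _≟A_ a b (x ∷ mapMaybe proj u))
        ∎
    where open ≡-Reasoning
  ...   | no x∉ab = begin
      filter (WB.pair? (emb a) (emb b)) (emb x ∷ u)
        ≡⟨ filter-reject (WB.pair? (emb a) (emb b)) (x∉ab ∘ Sum.map emb-injective emb-injective) ⟩
      sub2 _≟B_ (emb a) (emb b) u
        ≡⟨ sub2-mapMaybe a b u ⟩
      map emb (sub2 _≟A_ a b (mapMaybe proj u))
        ≡⟨ cong (map emb) (filter-reject (WA.pair? a b) x∉ab) ⟨
      map emb (sub2 _≟A_ a b (x ∷ mapMaybe proj u))
        ∎
    where open ≡-Reasoning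

  count-mapMaybe : ∀ a u → count _≟B_ (emb a) u ≡ count _≟A_ a (mapMaybe proj u)
  count-mapMaybe a u = begin
    count _≟B_ (emb a) u                                ≡⟨ WB.count≡length-sub2 (emb a) u ⟩
    length (sub2 _≟B_ (emb a) (emb a) u)                ≡⟨ cong length (sub2-mapMaybe a a u) ⟩
    length (map emb (sub2 _≟A_ a a (mapMaybe proj u)))  ≡⟨ length-map emb (sub2 _≟A_ a a (mapMaybe proj u)) ⟩
    length (sub2 _≟A_ a a (mapMaybe proj u))            ≡⟨ WA.count≡length-sub2 a (mapMaybe proj u) ⟨
    count _≟A_ a (mapMaybe proj u)                      ∎
    where open ≡-Reasoning

  Alternate-mapMaybe : ∀ a b u → Alternate _≟B_ (emb a) (emb b) u ⇔ Alternate _≟A_ a b (mapMaybe proj u)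
  Alternate-mapMaybe a b u = begin
    Alternate _≟B_ (emb a) (emb b) u
      ≡⟨ cong (WB.Alternating (emb a) (emb b)) (sub2-mapMaybe a b u) ⟩
    WB.Alternating (emb a) (emb b) (map emb (sub2 _≟A_ a b (mapMaybe proj u)))
      ∼⟨ ⇔-sym (Alternating-map _≟A_ _≟B_ emb-injective (sub2 _≟A_ a b (mapMaybe proj u))) ⟩
    Alternate _≟A_ a b (mapMaybe proj u)
      ∎
    where open EquationalReasoning

module _ {A : Set} (_≟_ : DecidableEquality A) where

  private
    _≟⁺_ : DecidableEquality (Maybe A)
    _≟⁺_ = MaybeP.≡-dec _≟_
    module Just = Projection _≟_ _≟⁺_ just id (λ _ → refl) sym

  count-catMaybes : ∀ x s → count _≟⁺_ (just x) s ≡ count _≟_ x (catMaybes s)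
  count-catMaybes x s = trans (Just.count-mapMaybe x s) (cong (count _≟_ x ∘ catMaybes) (map-id s))

  Alternate-catMaybes : ∀ a b s → Alternate _≟⁺_ (just a) (just b) s ⇔ Alternate _≟_ a b (catMaybes s)
  Alternate-catMaybes a b s =
    subst (Alternate _≟⁺_ (just a) (just b) s ⇔_) (cong (Alternate _≟_ a b ∘ catMaybes) (map-id s))
          (Just.Alternate-mapMaybe a b s)

-- splice s t replaces the i-th nothing of s by the letters of t strictly between its (i-1)-th and
-- i-th nothing; once s is used up, the remaining letters of t follow.
splice : ∀ {X Y : Set} → List (Maybe X) → List (Maybe Y) → List (X ⊎ Y)
spliceBlock : ∀ {X Y : Set} → List (Maybe X) → List (Maybe Y) → List (X ⊎ Y)
splice []            t = map inj₂ (catMaybes t)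
splice (just x ∷ s)  t = inj₁ x ∷ splice s t
splice (nothing ∷ s) t = spliceBlock s t
spliceBlock s []            = splice s []
spliceBlock s (just y ∷ t)  = inj₂ y ∷ spliceBlock s t
spliceBlock s (nothing ∷ t) = splice s t

isInj₁≡just : ∀ {X Y : Set} {y : X ⊎ Y} {x} → isInj₁ y ≡ just x → inj₁ x ≡ y
isInj₁≡just {y = inj₁ _} refl = refl

isInj₂≡just : ∀ {X Y : Set} {y : X ⊎ Y} {x} → isInj₂ y ≡ just x → inj₂ x ≡ y
isInj₂≡just {y = inj₂ _} refl = refl

module _ {X Y : Set} where

  mapMaybe-isInj₁-splice : ∀ (s : List (Maybe X)) (t : List (Maybe Y)) →
                           mapMaybe isInj₁ (splice s t) ≡ catMaybes s
  mapMaybe-isInj₁-spliceBlock : ∀ (s : List (Maybe X)) (t : List (Maybe Y)) →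
                                mapMaybe isInj₁ (spliceBlock s t) ≡ catMaybes s
  mapMaybe-isInj₁-splice []            t = mapMaybeIsInj₁∘mapInj₂ (catMaybes t)
  mapMaybe-isInj₁-splice (just x ∷ s)  t = cong (x ∷_) (mapMaybe-isInj₁-splice s t)
  mapMaybe-isInj₁-splice (nothing ∷ s) t = mapMaybe-isInj₁-spliceBlock s t
  mapMaybe-isInj₁-spliceBlock s []            = mapMaybe-isInj₁-splice s []
  mapMaybe-isInj₁-spliceBlock s (just y ∷ t)  = mapMaybe-isInj₁-spliceBlock s t
  mapMaybe-isInj₁-spliceBlock s (nothing ∷ t) = mapMaybe-isInj₁-splice s t

  mapMaybe-isInj₂-splice : ∀ (s : List (Maybe X)) (t : List (Maybe Y)) →
                           mapMaybe isInj₂ (splice s t) ≡ catMaybes t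
  mapMaybe-isInj₂-spliceBlock : ∀ (s : List (Maybe X)) (t : List (Maybe Y)) →
                                mapMaybe isInj₂ (spliceBlock s t) ≡ catMaybes t
  mapMaybe-isInj₂-splice []            t = mapMaybeIsInj₂∘mapInj₂ (catMaybes t)
  mapMaybe-isInj₂-splice (just x ∷ s)  t = mapMaybe-isInj₂-splice s t
  mapMaybe-isInj₂-splice (nothing ∷ s) t = mapMaybe-isInj₂-spliceBlock s t
  mapMaybe-isInj₂-spliceBlock s []            = mapMaybe-isInj₂-splice s []
  mapMaybe-isInj₂-spliceBlock s (just y ∷ t)  = cong (y ∷_) (mapMaybe-isInj₂-spliceBlock s t)
  mapMaybe-isInj₂-spliceBlock s (nothing ∷ t) = mapMaybe-isInj₂-splice s t

  module _ {P : Pred (X ⊎ Y) 0ℓ} (P? : Decidable P) where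

    private
      P₁? : Decidable (MaybeAll.All (P ∘ inj₁))
      P₁? = MaybeAll.dec (P? ∘ inj₁)
      P₂? : Decidable (MaybeAll.All (P ∘ inj₂))
      P₂? = MaybeAll.dec (P? ∘ inj₂)

    filter-map-inj₂-catMaybes : ∀ t → filter P? (map inj₂ (catMaybes t)) ≡ map inj₂ (catMaybes (filter P₂? t))
    filter-map-inj₂-catMaybes []            = refl
    filter-map-inj₂-catMaybes (nothing ∷ t) = filter-map-inj₂-catMaybes t
    filter-map-inj₂-catMaybes (just y ∷ t) with P? (inj₂ y)
    ... | yes _ = cong (inj₂ y ∷_) (filter-map-inj₂-catMaybes t)
    ... | no _  = filter-map-inj₂-catMaybes t

    filter-splice : ∀ s t → filter P? (splice s t) ≡ splice (filter P₁? s) (filter P₂? t)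
    filter-spliceBlock : ∀ s t → filter P? (spliceBlock s t) ≡ spliceBlock (filter P₁? s) (filter P₂? t)
    filter-splice [] t = filter-map-inj₂-catMaybes t
    filter-splice (just x ∷ s) t with P? (inj₁ x)
    ... | yes _ = cong (inj₁ x ∷_) (filter-splice s t)
    ... | no _  = filter-splice s t
    filter-splice (nothing ∷ s) t = filter-spliceBlock s t
    filter-spliceBlock s [] = filter-splice s []
    filter-spliceBlock s (just y ∷ t) with P? (inj₂ y)
    ... | yes _ = cong (inj₂ y ∷_) (filter-spliceBlock s t)
    ... | no _  = filter-spliceBlock s t
    filter-spliceBlock s (nothing ∷ t) = filter-splice s t

  SeparatedBy-map-inj₂-catMaybes : ∀ {a : X} (t : List (Maybe Y)) →
                                   SeparatedBy (inj₁ a) (map inj₂ (catMaybes t)) → SeparatedBy nothing t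
  SeparatedBy-map-inj₂-catMaybes []                     _   = []
  SeparatedBy-map-inj₂-catMaybes (nothing ∷ t)          sep =
    SeparatedBy-∷ (SeparatedBy-map-inj₂-catMaybes t sep)
  SeparatedBy-map-inj₂-catMaybes (just _ ∷ [])          _   = [-]
  SeparatedBy-map-inj₂-catMaybes (just _ ∷ nothing ∷ t) sep =
    inj₂ refl ∷ SeparatedBy-map-inj₂-catMaybes (nothing ∷ t) (Linked.tail sep)
  SeparatedBy-map-inj₂-catMaybes (just _ ∷ just _ ∷ _)  (inj₁ () ∷ _)
  SeparatedBy-map-inj₂-catMaybes (just _ ∷ just _ ∷ _)  (inj₂ () ∷ _)

  SeparatedBy-splice : ∀ {a : X} s (t : List (Maybe Y)) → SeparatedBy (inj₁ a) (splice s t) → SeparatedBy nothing t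
  SeparatedBy-spliceBlock : ∀ {a : X} s (t : List (Maybe Y)) →
                            SeparatedBy (inj₁ a) (spliceBlock s t) → SeparatedBy nothing t
  SeparatedBy-splice []            t sep = SeparatedBy-map-inj₂-catMaybes t sep
  SeparatedBy-splice (just _ ∷ s)  t sep = SeparatedBy-splice s t (Linked.tail sep)
  SeparatedBy-splice (nothing ∷ s) t sep = SeparatedBy-spliceBlock s t sep
  SeparatedBy-spliceBlock s []                     _   = []
  SeparatedBy-spliceBlock s (nothing ∷ t)          sep = SeparatedBy-∷ (SeparatedBy-splice s t sep)
  SeparatedBy-spliceBlock s (just _ ∷ [])          _   = [-]
  SeparatedBy-spliceBlock s (just _ ∷ nothing ∷ t) sep =
    inj₂ refl ∷ SeparatedBy-spliceBlock s (nothing ∷ t) (Linked.tail sep)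
  SeparatedBy-spliceBlock s (just _ ∷ just _ ∷ _)  (inj₁ () ∷ _)
  SeparatedBy-spliceBlock s (just _ ∷ just _ ∷ _)  (inj₂ () ∷ _)

  module _ (_≟X_ : DecidableEquality X) (_≟Y_ : DecidableEquality Y) where

    private
      _≟X⁺_ : DecidableEquality (Maybe X)
      _≟X⁺_ = MaybeP.≡-dec _≟X_
      _≟Y⁺_ : DecidableEquality (Maybe Y)
      _≟Y⁺_ = MaybeP.≡-dec _≟Y_
      _≟XY_ : DecidableEquality (X ⊎ Y)
      _≟XY_ = SumP.≡-dec _≟X_ _≟Y_
      module WX⁺ = Words _≟X⁺_
      module WY⁺ = Words _≟Y⁺_
      module WXY = Words _≟XY_
      module Inj₁ = Projection _≟X_ _≟XY_ inj₁ isInj₁ (λ _ → refl) isInj₁≡just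
      module Inj₂ = Projection _≟Y_ _≟XY_ inj₂ isInj₂ (λ _ → refl) isInj₂≡just

    Alternate-splice-inj₁ : ∀ a a' s t →
                            Alternate _≟XY_ (inj₁ a) (inj₁ a') (splice s t) ⇔ Alternate _≟X⁺_ (just a) (just a') s
    Alternate-splice-inj₁ a a' s t = begin
      Alternate _≟XY_ (inj₁ a) (inj₁ a') (splice s t)     ∼⟨ Inj₁.Alternate-mapMaybe a a' (splice s t) ⟩
      Alternate _≟X_ a a' (mapMaybe isInj₁ (splice s t))  ≡⟨ cong (Alternate _≟X_ a a') (mapMaybe-isInj₁-splice s t) ⟩
      Alternate _≟X_ a a' (catMaybes s)                   ∼⟨ ⇔-sym (Alternate-catMaybes _≟X_ a a' s) ⟩
      Alternate _≟X⁺_ (just a) (just a') s                ∎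
      where open EquationalReasoning

    Alternate-splice-inj₂ : ∀ b b' s t →
                            Alternate _≟XY_ (inj₂ b) (inj₂ b') (splice s t) ⇔ Alternate _≟Y⁺_ (just b) (just b') t
    Alternate-splice-inj₂ b b' s t = begin
      Alternate _≟XY_ (inj₂ b) (inj₂ b') (splice s t)     ∼⟨ Inj₂.Alternate-mapMaybe b b' (splice s t) ⟩
      Alternate _≟Y_ b b' (mapMaybe isInj₂ (splice s t))  ≡⟨ cong (Alternate _≟Y_ b b') (mapMaybe-isInj₂-splice s t) ⟩
      Alternate _≟Y_ b b' (catMaybes t)                   ∼⟨ ⇔-sym (Alternate-catMaybes _≟Y_ b b' t) ⟩
      Alternate _≟Y⁺_ (just b) (just b') t                ∎
      where open EquationalReasoning

    Uniform-splice : ∀ {k} s t → Uniform _≟X⁺_ k s → Uniform _≟Y⁺_ k t → Uniform _≟XY_ k (splice s t)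
    Uniform-splice {k} s t s-uni t-uni (inj₁ x) = begin
      count _≟XY_ (inj₁ x) (splice s t)           ≡⟨ Inj₁.count-mapMaybe x (splice s t) ⟩
      count _≟X_ x (mapMaybe isInj₁ (splice s t)) ≡⟨ cong (count _≟X_ x) (mapMaybe-isInj₁-splice s t) ⟩
      count _≟X_ x (catMaybes s)                  ≡⟨ count-catMaybes _≟X_ x s ⟨
      count _≟X⁺_ (just x) s                      ≡⟨ s-uni (just x) ⟩
      k                                           ∎
      where open ≡-Reasoning
    Uniform-splice {k} s t s-uni t-uni (inj₂ y) = begin
      count _≟XY_ (inj₂ y) (splice s t)           ≡⟨ Inj₂.count-mapMaybe y (splice s t) ⟩
      count _≟Y_ y (mapMaybe isInj₂ (splice s t)) ≡⟨ cong (count _≟Y_ y) (mapMaybe-isInj₂-splice s t) ⟩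
      count _≟Y_ y (catMaybes t)                  ≡⟨ count-catMaybes _≟Y_ y t ⟨
      count _≟Y⁺_ (just y) t                      ≡⟨ t-uni (just y) ⟩
      k                                           ∎
      where open ≡-Reasoning

    splice-pairs : ∀ (b : Y) s j → count _≟X⁺_ nothing s ≡ j →
                   splice s (altWord _≟Y⁺_ (just b) nothing (double j)) ≡ map (maybe′ inj₁ (inj₂ b)) s
    splice-pairs b []            zero    _ = refl
    splice-pairs b (just x ∷ s)  j       e =
      cong (inj₁ x ∷_) (splice-pairs b s j (trans (sym (WX⁺.count-there {y = just x} s (λ ()))) e))
    splice-pairs b (nothing ∷ s) zero    e with () ← trans (sym (WX⁺.count-here nothing s)) e
    splice-pairs b (nothing ∷ s) (suc j) e =
      cong (inj₂ b ∷_) (splice-pairs b s j (suc-injective (trans (sym (WX⁺.count-here nothing s)) e)))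

    sub2-splice : ∀ a b s t → sub2 _≟XY_ (inj₁ a) (inj₂ b) (splice s t) ≡
                              splice (sub2 _≟X⁺_ (just a) nothing s) (sub2 _≟Y⁺_ (just b) nothing t)
    sub2-splice a b s t =
      trans (filter-splice (WXY.pair? (inj₁ a) (inj₂ b)) s t)
            (cong₂ splice (filter-≐ _ (WX⁺.pair? (just a) nothing) (left⊆ , left⊇) s)
                          (filter-≐ _ (WY⁺.pair? (just b) nothing) (right⊆ , right⊇) t))
      where
      left⊆ : ∀ {y} → MaybeAll.All (λ x → inj₁ x ≡ inj₁ a ⊎ inj₁ x ≡ inj₂ b) y → y ≡ just a ⊎ y ≡ nothing
      left⊆ (MaybeAll.just (inj₁ refl)) = inj₁ refl
      left⊆ MaybeAll.nothing            = inj₂ refl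
      left⊇ : ∀ {y} → y ≡ just a ⊎ y ≡ nothing → MaybeAll.All (λ x → inj₁ x ≡ inj₁ a ⊎ inj₁ x ≡ inj₂ b) y
      left⊇ (inj₁ refl) = MaybeAll.just (inj₁ refl)
      left⊇ (inj₂ refl) = MaybeAll.nothing
      right⊆ : ∀ {y} → MaybeAll.All (λ z → inj₂ z ≡ inj₁ a ⊎ inj₂ z ≡ inj₂ b) y → y ≡ just b ⊎ y ≡ nothing
      right⊆ (MaybeAll.just (inj₂ refl)) = inj₁ refl
      right⊆ MaybeAll.nothing            = inj₂ refl
      right⊇ : ∀ {y} → y ≡ just b ⊎ y ≡ nothing → MaybeAll.All (λ z → inj₂ z ≡ inj₁ a ⊎ inj₂ z ≡ inj₂ b) y
      right⊇ (inj₁ refl) = MaybeAll.just (inj₂ refl)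
      right⊇ (inj₂ refl) = MaybeAll.nothing

    module _ {k} (w : List (Maybe X)) (v₀ : List (Maybe Y))
             (w-uni : Uniform _≟X⁺_ k w) (v-uni : Uniform _≟Y⁺_ k (v₀ ∷ʳ nothing)) (a : X) (b : Y) where

      private
        v t t₀ : List (Maybe Y)
        v  = v₀ ∷ʳ nothing
        t  = sub2 _≟Y⁺_ (just b) nothing v
        t₀ = sub2 _≟Y⁺_ (just b) nothing v₀
        s : List (Maybe X)
        s = sub2 _≟X⁺_ (just a) nothing w
        fill : Maybe X → X ⊎ Y
        fill = maybe′ inj₁ (inj₂ b)

        fill-injective : Injective _≡_ _≡_ fill
        fill-injective {just _}  {just _}  refl = refl
        fill-injective {nothing} {nothing} _    = refl
        fill-injective {just _}  {nothing} ()
        fill-injective {nothing} {just _}  ()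

        t≡t₀∷ʳnothing : t ≡ t₀ ∷ʳ nothing
        t≡t₀∷ʳnothing = filter-++ (WY⁺.pair? (just b) nothing) v₀ [ nothing ]

        count-nothing-s : count _≟X⁺_ nothing s ≡ k
        count-nothing-s = trans (WX⁺.count-filter (WX⁺.pair? (just a) nothing) w (inj₂ refl)) (w-uni nothing)

        count-nothing-t : count _≟Y⁺_ nothing t ≡ k
        count-nothing-t = trans (WY⁺.count-filter (WY⁺.pair? (just b) nothing) v (inj₂ refl)) (v-uni nothing)

        t-balanced : WY⁺.Balanced (just b) nothing t
        t-balanced = WY⁺.Balanced-sub2 v (trans (v-uni (just b)) (sym (v-uni nothing)))

        pairs-size : ∀ j → t ≡ altWord _≟Y⁺_ (just b) nothing (double j) → j ≡ k
        pairs-size j e =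
          trans (sym (WY⁺.count-altWord-double (λ ()) j)) (trans (cong (count _≟Y⁺_ nothing) (sym e)) count-nothing-t)

        separated⇒pairs : SeparatedBy nothing t → t ≡ altWord _≟Y⁺_ (just b) nothing (double k)
        separated⇒pairs sep
          with j , e ← WY⁺.SeparatedBy-Balanced⇒pairs (λ ()) t₀ (all-filter (WY⁺.pair? (just b) nothing) v₀)
                         (subst (SeparatedBy nothing) t≡t₀∷ʳnothing sep)
                         (subst (WY⁺.Balanced (just b) nothing) t≡t₀∷ʳnothing t-balanced)
          with refl ← pairs-size j (trans t≡t₀∷ʳnothing e) = trans t≡t₀∷ʳnothing e

        sub2-splice-separated : SeparatedBy nothing t → sub2 _≟XY_ (inj₁ a) (inj₂ b) (splice w v) ≡ map fill s
        sub2-splice-separated sep = begin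
          sub2 _≟XY_ (inj₁ a) (inj₂ b) (splice w v)            ≡⟨ sub2-splice a b w v ⟩
          splice s t                                           ≡⟨ cong (splice s) (separated⇒pairs sep) ⟩
          splice s (altWord _≟Y⁺_ (just b) nothing (double k)) ≡⟨ splice-pairs b s k count-nothing-s ⟩
          map fill s                                           ∎
          where open ≡-Reasoning

      Alternate-splice-cross : Alternate _≟XY_ (inj₁ a) (inj₂ b) (splice w v) ⇔
                               (Alternate _≟X⁺_ (just a) nothing w × Alternate _≟Y⁺_ (just b) nothing v)
      Alternate-splice-cross = mk⇔ to from
        where
        to : Alternate _≟XY_ (inj₁ a) (inj₂ b) (splice w v) →
             Alternate _≟X⁺_ (just a) nothing w × Alternate _≟Y⁺_ (just b) nothing v
        to alt = Equivalence.from (Alternating-map _≟X⁺_ _≟XY_ fill-injective s)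
                   (subst (WXY.Alternating (inj₁ a) (inj₂ b)) (sub2-splice-separated sep) alt)
               , (double k , inj₁ (separated⇒pairs sep))
          where
          sep : SeparatedBy nothing t
          sep = SeparatedBy-splice s t
                  (proj₁ (WXY.Alternating⇒SeparatedBy (subst (WXY.Alternating (inj₁ a) (inj₂ b)) (sub2-splice a b w v) alt)))
        from : Alternate _≟X⁺_ (just a) nothing w × Alternate _≟Y⁺_ (just b) nothing v →
               Alternate _≟XY_ (inj₁ a) (inj₂ b) (splice w v)
        from (alt-w , alt-v) =
          subst (WXY.Alternating (inj₁ a) (inj₂ b)) (sym (sub2-splice-separated (proj₂ (WY⁺.Alternating⇒SeparatedBy alt-v))))
            (Equivalence.to (Alternating-map _≟X⁺_ _≟XY_ fill-injective s) alt-w)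

module _ {n n' : ℕ} (G : Graph (Maybe (Fin n))) (G' : Graph (Maybe (Fin n'))) where

  Adj-∗⇔Alternate-splice : ∀ {k} w v₀ → Uniform decM k w → Uniform decM k (v₀ ∷ʳ nothing) →
                           (∀ a b → a ≢ b → Adj G a b ⇔ Alternate decM a b w) →
                           (∀ a b → a ≢ b → Adj G' a b ⇔ Alternate decM a b (v₀ ∷ʳ nothing)) →
                           ∀ p q → p ≢ q → Adj (G ∗ G') p q ⇔ Alternate decS p q (splice w (v₀ ∷ʳ nothing))
  Adj-∗⇔Alternate-splice w v₀ _ _ w-rep _ (inj₁ a) (inj₁ a') a≢a' =
    ⇔-sym (Alternate-splice-inj₁ FinP._≟_ FinP._≟_ a a' w (v₀ ∷ʳ nothing))
      ⇔-∘ w-rep (just a) (just a') (a≢a' ∘ cong inj₁ ∘ just-injective)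
  Adj-∗⇔Alternate-splice w v₀ _ _ _ v-rep (inj₂ b) (inj₂ b') b≢b' =
    ⇔-sym (Alternate-splice-inj₂ FinP._≟_ FinP._≟_ b b' w (v₀ ∷ʳ nothing))
      ⇔-∘ v-rep (just b) (just b') (b≢b' ∘ cong inj₂ ∘ just-injective)
  Adj-∗⇔Alternate-splice w v₀ w-uni v-uni w-rep v-rep (inj₁ a) (inj₂ b) _ =
    ⇔-sym (Alternate-splice-cross FinP._≟_ FinP._≟_ w v₀ w-uni v-uni a b)
      ⇔-∘ (w-rep (just a) nothing (λ ()) ×-⇔ v-rep (just b) nothing (λ ()))
  Adj-∗⇔Alternate-splice w v₀ w-uni v-uni w-rep v-rep (inj₂ b) (inj₁ a) _ =
    Words.Alternate-sym decS (inj₁ a) (inj₂ b) (splice w (v₀ ∷ʳ nothing))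
      ⇔-∘ Adj-∗⇔Alternate-splice w v₀ w-uni v-uni w-rep v-rep (inj₁ a) (inj₂ b) (λ ())

theorem1 : (k : ℕ) → 1 ≤ k → (n n' : ℕ)
    → (G : Graph (Maybe (Fin n))) → (G' : Graph (Maybe (Fin n')))
    → Connected G → Connected G'
    → KRepresentable decM k G → KRepresentable decM k G'
    → KRepresentable decS k (G ∗ G')
theorem1 (suc k) _ n n' G G' _ _ (w , w-uni , _ , w-rep) (w' , w'-uni , w'-∈ , w'-rep)
  with v₀ , v-uni , w'⇔v ← Words.rotate-to-end decM w' w'-uni (w'-∈ nothing) =
  W , W-uni , (λ x → Words.count≡suc⇒∈ decS (W-uni x)) ,
  Adj-∗⇔Alternate-splice G G' w v₀ w-uni v-uni w-rep (λ a b a≢b → w'⇔v a b a≢b ⇔-∘ w'-rep a b a≢b)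
  where
  W : List (Fin n ⊎ Fin n')
  W = splice w (v₀ ∷ʳ nothing)
  W-uni : Uniform decS (suc k) W
  W-uni = Uniform-splice FinP._≟_ FinP._≟_ w (v₀ ∷ʳ nothing) w-uni v-uni
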